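{- Let $c$ be a $4$-coloring of the nonzero rational numbers without a monochromatic solution to $x_1+x_2+x_3=4x_4$. Then for every nonzero rational number $x$, $c(x)\neq c(4x)$.
   Context: A solution is a quadruple of nonzero rationals (not necessarily distinct) satisfying the equation; it is monochromatic if all entries have the same color. -}

module Defs where

open import Data.Empty using (⊥)
open import Data.Fin using (Fin)
open import Data.Integer using (+_)
open import Data.Rational using (ℚ; 0ℚ; _+_; _*_; _/_)
open import Data.Product using (_×_)
open import Relation.Binary.PropositionalEquality using (_≡_; _≢_)

4ℚ : ℚ
4ℚ = + 4 / 1

IsSolution : ℚ → ℚ → ℚ → ℚ → Set
IsSolution x₁ x₂ x₃ x₄ =
  x₁ ≢ 0ℚ × x₂ ≢ 0ℚ × x₃ ≢ 0ℚ × x₄ ≢ 0ℚ × (x₁ + x₂ + x₃ ≡ 4ℚ * x₄)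

-- A 4-coloring c of the nonzero rationals (modelled as a function on ℚ whose
-- value at 0 is irrelevant) has no monochromatic solution.
NoMonoSolution : (ℚ → Fin 4) → Set
NoMonoSolution c = ∀ x₁ x₂ x₃ x₄ → IsSolution x₁ x₂ x₃ x₄ →
  c x₁ ≡ c x₄ → c x₂ ≡ c x₄ → c x₃ ≡ c x₄ → ⊥

-- Dilating by x and permuting the colours, we may assume x = 1 and that 1 and 4 both get
-- colour 0.  The rest is a finite search: a case split on the colours of the points k / 6
-- (0 < k ≤ 36) in which every branch ends in a monochromatic solution.
module Submission where

open import Defs
open import Data.Fin using (Fin; zero; suc)
open import Data.Fin.Permutation.Components using (transpose; transpose-inverse)
import Data.Fin.Properties as Fin
open import Data.List using (List; []; _∷_)
open import Data.List.Membership.Propositional using (_∈_)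
open import Data.List.Relation.Unary.All as All using (All; []; _∷_)
open import Data.Nat using (ℕ)
import Data.Nat.Properties as ℕ
open import Data.Integer using (+_)
open import Data.Product using (_×_; _,_; ∃)
open import Data.Product.Properties using (≡-dec)
open import Data.List.Membership.DecPropositional (≡-dec ℕ._≟_ (Fin._≟_ {4})) using (_∈?_)
open import Data.Rational using (ℚ; 0ℚ; 1ℚ; _+_; _*_; _/_; _≟_; 1/_; NonZero; ≢-nonZero)
open import Data.Rational.Properties using (*-assoc; *-identityˡ; *-distribʳ-+; *-inverseˡ; *-zeroʳ)
open import Function using (_∘_)
open import Function.Definitions using (Injective)
open import Relation.Nullary using (Dec; ¬_; ¬?)
open import Relation.Nullary.Decidable using (_×-dec_; from-yes; dec-true)
open import Relation.Binary.PropositionalEquality using (_≡_; _≢_; refl; sym; trans; cong)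
open Relation.Binary.PropositionalEquality.≡-Reasoning

*-≢0 : ∀ {p q : ℚ} → p ≢ 0ℚ → q ≢ 0ℚ → p * q ≢ 0ℚ
*-≢0 {p} {q} p≢0 q≢0 pq≡0 = q≢0 (begin
    q                  ≡⟨ sym (*-identityˡ q) ⟩
    1ℚ * q             ≡⟨ cong (_* q) (sym (*-inverseˡ p)) ⟩
    (1/ p * p) * q     ≡⟨ *-assoc (1/ p) p q ⟩
    1/ p * (p * q)     ≡⟨ cong (1/ p *_) pq≡0 ⟩
    1/ p * 0ℚ          ≡⟨ *-zeroʳ (1/ p) ⟩
    0ℚ                 ∎)
  where instance _ : NonZero p
                 _ = ≢-nonZero p≢0

solution? : ∀ x₁ x₂ x₃ x₄ → Dec (IsSolution x₁ x₂ x₃ x₄)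
solution? x₁ x₂ x₃ x₄ =
  ¬? (x₁ ≟ 0ℚ) ×-dec ¬? (x₂ ≟ 0ℚ) ×-dec ¬? (x₃ ≟ 0ℚ) ×-dec ¬? (x₄ ≟ 0ℚ) ×-dec
  (x₁ + x₂ + x₃ ≟ 4ℚ * x₄)

IsSolution-dilate : ∀ {x₁ x₂ x₃ x₄} y → y ≢ 0ℚ → IsSolution x₁ x₂ x₃ x₄ →
  IsSolution (x₁ * y) (x₂ * y) (x₃ * y) (x₄ * y)
IsSolution-dilate {x₁} {x₂} {x₃} {x₄} y y≢0 (x₁≢0 , x₂≢0 , x₃≢0 , x₄≢0 , sum≡) =
  *-≢0 x₁≢0 y≢0 , *-≢0 x₂≢0 y≢0 , *-≢0 x₃≢0 y≢0 , *-≢0 x₄≢0 y≢0 , (begin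
    x₁ * y + x₂ * y + x₃ * y  ≡⟨ cong (_+ x₃ * y) (sym (*-distribʳ-+ y x₁ x₂)) ⟩
    (x₁ + x₂) * y + x₃ * y    ≡⟨ sym (*-distribʳ-+ y (x₁ + x₂) x₃) ⟩
    (x₁ + x₂ + x₃) * y        ≡⟨ cong (_* y) sum≡ ⟩
    (4ℚ * x₄) * y             ≡⟨ *-assoc 4ℚ x₄ y ⟩
    4ℚ * (x₄ * y)             ∎)

NoMonoSolution-dilate : ∀ {c} y → y ≢ 0ℚ → NoMonoSolution c → NoMonoSolution (c ∘ (_* y))
NoMonoSolution-dilate y y≢0 noMono x₁ x₂ x₃ x₄ sol =
  noMono _ _ _ _ (IsSolution-dilate y y≢0 sol)

NoMonoSolution-recolour : ∀ {c} {f : Fin 4 → Fin 4} → Injective _≡_ _≡_ f →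
  NoMonoSolution c → NoMonoSolution (f ∘ c)
NoMonoSolution-recolour f-inj noMono x₁ x₂ x₃ x₄ sol e₁ e₂ e₃ =
  noMono x₁ x₂ x₃ x₄ sol (f-inj e₁) (f-inj e₂) (f-inj e₃)

transpose-matchˡ : ∀ {n} (i j : Fin n) → transpose i j i ≡ j
transpose-matchˡ i j rewrite dec-true (i Fin.≟ i) refl = refl

transpose-injective : ∀ {n} (i j : Fin n) → Injective _≡_ _≡_ (transpose i j)
transpose-injective i j {k} {l} e = begin
  k                               ≡⟨ sym (transpose-inverse j i) ⟩
  transpose j i (transpose i j k) ≡⟨ cong (transpose j i) e ⟩
  transpose j i (transpose i j l) ≡⟨ transpose-inverse j i ⟩
  l                               ∎

point : ℕ → ℚ
point k = + k / 6

PartialColouring : Set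
PartialColouring = List (ℕ × Fin 4)

Extends : (ℚ → Fin 4) → PartialColouring → Set
Extends c = All λ (k , col) → c (point k) ≡ col

MonochromaticIn : PartialColouring → (i j k l : ℕ) → Set
MonochromaticIn ρ i j k l =
  ∃ λ col → (i , col) ∈ ρ × (j , col) ∈ ρ × (k , col) ∈ ρ × (l , col) ∈ ρ

data Refutation : Set where
  leaf  : (i j k l : ℕ) → Refutation
  split : (k : ℕ) (t₀ t₁ t₂ t₃ : Refutation) → Refutation

Refutes : PartialColouring → Refutation → Set
Refutes ρ (leaf i j k l) =
  IsSolution (point i) (point j) (point k) (point l) × MonochromaticIn ρ i j k l
Refutes ρ (split k t₀ t₁ t₂ t₃) =
  Refutes ((k , zero) ∷ ρ) t₀ × Refutes ((k , suc zero) ∷ ρ) t₁ ×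
  Refutes ((k , suc (suc zero)) ∷ ρ) t₂ × Refutes ((k , suc (suc (suc zero))) ∷ ρ) t₃

refutes? : ∀ ρ t → Dec (Refutes ρ t)
refutes? ρ (leaf i j k l) =
  solution? (point i) (point j) (point k) (point l) ×-dec
  Fin.any? λ col →
    ((i , col) ∈? ρ) ×-dec ((j , col) ∈? ρ) ×-dec ((k , col) ∈? ρ) ×-dec ((l , col) ∈? ρ)
refutes? ρ (split k t₀ t₁ t₂ t₃) =
  refutes? _ t₀ ×-dec refutes? _ t₁ ×-dec refutes? _ t₂ ×-dec refutes? _ t₃

Refutes-sound : ∀ {c} → NoMonoSolution c → ∀ {ρ} t → Refutes ρ t → ¬ Extends c ρ
Refutes-sound noMono (leaf i j k l) (sol , col , i∈ρ , j∈ρ , k∈ρ , l∈ρ) ext =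
  noMono _ _ _ _ sol (trans (colour i∈ρ) (sym (colour l∈ρ)))
    (trans (colour j∈ρ) (sym (colour l∈ρ))) (trans (colour k∈ρ) (sym (colour l∈ρ)))
  where colour = All.lookup ext
Refutes-sound {c} noMono (split k t₀ t₁ t₂ t₃) (r₀ , r₁ , r₂ , r₃) ext with c (point k) in ck
... | zero                 = Refutes-sound noMono t₀ r₀ (ck ∷ ext)
... | suc zero             = Refutes-sound noMono t₁ r₁ (ck ∷ ext)
... | suc (suc zero)       = Refutes-sound noMono t₂ r₂ (ck ∷ ext)
... | suc (suc (suc zero)) = Refutes-sound noMono t₃ r₃ (ck ∷ ext)

-- Found by computer search; in every leaf i + j + k = 4 l.
certificate : Refutation
certificate =
  split 16 (leaf 16 24 24 16) (split 12 (leaf 6 6 12 6) (leaf 16 16 16 12) (split 8 (leaf 8 8 8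
  6) (leaf 8 8 16 8) (leaf 8 12 12 8) (split 18 (leaf 24 24 24 18) (split 9 (leaf 6 6 24 9)
  (leaf 9 9 18 9) (leaf 12 12 12 9) (split 4 (leaf 4 6 6 4) (split 10 (leaf 6 10 24 10) (leaf 4
  18 18 10) (split 14 (split 28 (leaf 14 14 28 14) (leaf 16 28 28 18) (leaf 10 10 28 12) (split
  15 (split 20 (leaf 20 20 20 15) (split 11 (leaf 6 14 24 11) (leaf 4 20 20 11) (split 21 (leaf
  14 21 21 14) (split 7 (leaf 6 7 15 7) (leaf 4 4 20 7) (leaf 7 10 11 7) (split 22 (leaf 14 22
  24 15) (leaf 20 22 22 16) (leaf 10 12 22 11) (leaf 7 7 22 9))) (leaf 11 12 21 11) (leaf 28 28
  28 21)) (leaf 8 8 28 11)) (leaf 10 10 20 10) (leaf 8 8 20 9)) (split 11 (leaf 6 14 24 11)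
  (leaf 11 15 18 11) (split 21 (leaf 14 21 21 14) (leaf 18 21 21 15) (leaf 11 12 21 11) (leaf 28
  28 28 21)) (leaf 8 8 28 11)) (leaf 10 15 15 10) (leaf 8 9 15 8))) (split 19 (split 20 (split
  15 (leaf 20 20 20 15) (split 26 (leaf 24 26 26 19) (leaf 4 26 26 14) (leaf 10 12 26 12) (split
  13 (leaf 13 19 20 13) (leaf 16 18 18 13) (split 11 (leaf 6 19 19 11) (leaf 11 15 18 11) (split
  2 (leaf 2 2 20 6) (leaf 2 2 4 2) (split 3 (leaf 3 3 6 3) (leaf 4 4 4 3) (leaf 2 3 3 2) (leaf 3
  3 26 8)) (leaf 2 8 26 9)) (leaf 9 9 26 11)) (leaf 13 13 26 13))) (leaf 10 15 15 10) (leaf 8 9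
  15 8)) (leaf 16 20 20 14) (leaf 10 10 20 10) (leaf 8 8 20 9)) (leaf 18 19 19 14) (leaf 10 19
  19 12) (leaf 8 9 19 9)) (leaf 12 14 14 10) (leaf 8 14 14 9)) (split 13 (split 23 (leaf 6 23 23
  13) (leaf 18 23 23 16) (split 14 (leaf 14 14 24 13) (split 22 (leaf 6 22 24 13) (leaf 16 18 22
  14) (split 15 (leaf 13 15 24 13) (split 11 (split 17 (leaf 11 17 24 13) (split 19 (leaf 6 19
  19 11) (leaf 18 19 19 14) (split 7 (leaf 6 7 11 6) (leaf 4 7 17 7) (leaf 7 19 22 12) (leaf 8
  10 10 7)) (leaf 8 9 19 9)) (leaf 22 23 23 17) (leaf 9 10 17 9)) (leaf 11 15 18 11) (leaf 11 11
  22 11) (leaf 10 11 11 8)) (leaf 15 22 23 15) (leaf 8 9 15 8)) (leaf 8 10 22 10)) (split 15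
  (leaf 13 15 24 13) (split 22 (leaf 6 22 24 13) (leaf 16 22 22 15) (leaf 12 14 22 12) (leaf 8
  10 22 10)) (leaf 14 23 23 15) (leaf 8 9 15 8)) (leaf 8 10 14 8)) (leaf 8 9 23 10)) (leaf 16 18
  18 13) (split 23 (split 20 (split 28 (leaf 24 28 28 20) (leaf 16 28 28 18) (leaf 12 12 28 13)
  (split 2 (leaf 2 2 20 6) (leaf 2 2 4 2) (split 3 (leaf 3 3 6 3) (leaf 4 4 4 3) (leaf 2 3 3 2)
  (leaf 3 9 28 10)) (leaf 2 2 28 8))) (split 22 (split 15 (leaf 15 22 23 15) (leaf 20 20 20 15)
  (split 11 (leaf 11 11 22 11) (leaf 4 20 20 11) (split 14 (split 17 (leaf 17 17 22 14) (split
  19 (leaf 14 19 23 14) (split 21 (leaf 14 21 21 14) (split 7 (leaf 7 7 14 7) (leaf 4 4 20 7)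
  (split 5 (leaf 5 5 14 6) (split 26 (leaf 6 24 26 14) (leaf 16 26 26 17) (leaf 7 11 26 11)
  (split 3 (leaf 3 3 6 3) (leaf 3 4 5 3) (leaf 3 12 13 7) (leaf 3 3 26 8))) (leaf 5 11 12 7)
  (leaf 5 5 10 5)) (leaf 8 10 10 7)) (leaf 11 12 21 11) (leaf 9 10 21 10)) (leaf 12 13 19 11)
  (leaf 8 9 19 9)) (leaf 12 15 17 11) (leaf 9 10 17 9)) (leaf 16 20 20 14) (leaf 14 15 15 11)
  (leaf 8 10 14 8)) (leaf 10 11 11 8)) (leaf 8 9 15 8)) (leaf 20 22 22 16) (leaf 13 13 22 12)
  (leaf 8 10 22 10)) (leaf 12 20 20 13) (leaf 8 8 20 9)) (leaf 18 23 23 16) (leaf 12 13 23 12)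
  (leaf 8 9 23 10)) (leaf 9 10 13 8))) (split 32 (leaf 32 32 32 24) (leaf 16 16 32 16) (leaf 4
  12 32 12) (split 2 (split 20 (leaf 2 2 20 6) (split 14 (split 15 (split 22 (leaf 14 22 24 15)
  (leaf 20 22 22 16) (leaf 4 22 22 12) (split 13 (leaf 13 15 24 13) (leaf 16 16 20 13) (split 28
  (leaf 14 14 28 14) (leaf 16 20 28 16) (leaf 12 12 28 13) (leaf 28 28 32 22)) (leaf 8 22 22
  13))) (leaf 20 20 20 15) (split 10 (leaf 2 14 24 10) (leaf 10 10 20 10) (leaf 10 15 15 10)
  (split 13 (leaf 14 14 24 13) (leaf 16 16 20 13) (split 21 (leaf 14 21 21 14) (split 7 (leaf 2
  2 24 7) (split 5 (leaf 5 5 14 6) (leaf 5 5 18 7) (leaf 4 4 12 5) (leaf 5 5 10 5)) (leaf 4 12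
  12 7) (leaf 8 10 10 7)) (leaf 12 15 21 12) (leaf 9 10 21 10)) (leaf 9 10 13 8))) (leaf 8 9 15
  8)) (leaf 16 20 20 14) (split 10 (leaf 6 10 24 10) (leaf 10 10 20 10) (leaf 12 14 14 10)
  (split 7 (leaf 2 2 24 7) (split 22 (split 13 (leaf 6 22 24 13) (leaf 16 16 20 13) (split 17
  (leaf 22 22 24 17) (split 11 (leaf 2 11 11 6) (leaf 7 17 20 11) (split 15 (split 23 (leaf 15
  22 23 15) (leaf 18 23 23 16) (leaf 11 14 23 12) (leaf 8 9 23 10)) (leaf 20 20 20 15) (leaf 14
  15 15 11) (leaf 8 9 15 8)) (leaf 10 11 11 8)) (leaf 14 17 17 12) (leaf 9 10 17 9)) (leaf 9 10
  13 8)) (leaf 20 22 22 16) (leaf 4 22 22 12) (leaf 8 10 22 10)) (leaf 4 12 12 7) (leaf 8 10 10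
  7))) (leaf 8 14 14 9)) (split 14 (split 13 (leaf 14 14 24 13) (leaf 16 18 18 13) (leaf 12 20
  20 13) (split 30 (leaf 2 24 30 14) (leaf 16 18 30 16) (leaf 20 30 30 20) (leaf 9 13 30 13)))
  (split 11 (leaf 2 11 11 6) (leaf 14 14 16 11) (leaf 4 20 20 11) (split 10 (leaf 6 10 24 10)
  (leaf 10 14 16 10) (leaf 10 10 20 10) (leaf 10 11 11 8))) (leaf 14 14 20 12) (leaf 8 14 14 9))
  (leaf 8 8 20 9)) (split 3 (leaf 3 3 6 3) (leaf 2 3 3 2) (leaf 4 4 4 3) (split 5 (split 14
  (leaf 5 5 14 6) (split 7 (leaf 6 7 7 5) (leaf 7 7 14 7) (leaf 4 12 12 7) (split 13 (leaf 5 6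
  13 6) (leaf 16 18 18 13) (split 10 (leaf 5 5 10 5) (leaf 10 14 16 10) (split 19 (split 26
  (leaf 24 26 26 19) (leaf 14 16 26 14) (leaf 4 10 26 10) (leaf 3 3 26 8)) (leaf 18 19 19 14)
  (leaf 10 19 19 12) (leaf 8 9 19 9)) (leaf 8 10 10 7)) (leaf 7 8 13 7))) (split 30 (split 20
  (leaf 20 30 30 20) (split 15 (leaf 6 24 30 15) (leaf 20 20 20 15) (split 10 (leaf 5 5 10 5)
  (leaf 2 18 20 10) (leaf 10 15 15 10) (split 13 (leaf 5 6 13 6) (leaf 16 16 20 13) (split 21
  (leaf 24 30 30 21) (split 11 (split 22 (leaf 11 11 22 11) (leaf 20 22 22 16) (leaf 4 22 22 12)
  (leaf 8 10 22 10)) (leaf 2 21 21 11) (leaf 14 15 15 11) (leaf 3 9 32 11)) (leaf 12 15 21 12)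
  (leaf 3 8 21 8)) (leaf 9 10 13 8))) (leaf 8 9 15 8)) (leaf 14 14 20 12) (leaf 3 9 20 8)) (leaf
  16 18 30 16) (leaf 4 14 30 12) (leaf 3 3 30 9)) (leaf 8 14 14 9)) (leaf 2 2 16 5) (leaf 4 4 12
  5) (leaf 3 8 9 5))) (leaf 2 2 4 2) (leaf 2 2 32 9))) (leaf 4 4 8 4))) (leaf 12 18 18 12)
  (split 9 (leaf 6 6 24 9) (split 4 (leaf 4 6 6 4) (leaf 4 16 16 9) (split 32 (leaf 32 32 32 24)
  (leaf 16 16 32 16) (leaf 4 12 32 12) (leaf 8 32 32 18)) (leaf 4 4 8 4)) (leaf 12 12 12 9)
  (leaf 9 9 18 9)))) (split 8 (leaf 8 8 8 6) (leaf 8 8 16 8) (split 18 (leaf 24 24 24 18) (split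
  9 (leaf 6 6 24 9) (leaf 9 9 18 9) (split 4 (leaf 4 6 6 4) (split 10 (leaf 6 10 24 10) (leaf 4
  18 18 10) (split 13 (split 23 (leaf 6 23 23 13) (leaf 18 23 23 16) (leaf 8 9 23 10) (split 14
  (leaf 14 14 24 13) (split 22 (leaf 6 22 24 13) (leaf 16 18 22 14) (leaf 8 10 22 10) (split 15
  (leaf 13 15 24 13) (split 11 (split 17 (leaf 11 17 24 13) (split 19 (leaf 6 19 19 11) (leaf 18
  19 19 14) (leaf 8 9 19 9) (split 7 (leaf 6 7 11 6) (leaf 4 7 17 7) (leaf 8 10 10 7) (leaf 7 19
  22 12))) (leaf 9 10 17 9) (leaf 22 23 23 17)) (leaf 11 15 18 11) (leaf 10 11 11 8) (leaf 11 11
  22 11)) (leaf 8 9 15 8) (leaf 15 22 23 15))) (leaf 8 10 14 8) (split 15 (leaf 13 15 24 13)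
  (split 22 (leaf 6 22 24 13) (leaf 16 22 22 15) (leaf 8 10 22 10) (leaf 12 14 22 12)) (leaf 8 9
  15 8) (leaf 14 23 23 15)))) (leaf 16 18 18 13) (leaf 9 10 13 8) (split 23 (split 20 (split 28
  (leaf 24 28 28 20) (leaf 16 28 28 18) (split 2 (leaf 2 2 20 6) (leaf 2 2 4 2) (leaf 2 2 28 8)
  (split 3 (leaf 3 3 6 3) (leaf 4 4 4 3) (leaf 3 9 28 10) (leaf 2 3 3 2))) (leaf 12 12 28 13))
  (split 22 (split 15 (leaf 15 22 23 15) (leaf 20 20 20 15) (leaf 8 9 15 8) (split 11 (leaf 11
  11 22 11) (leaf 4 20 20 11) (leaf 10 11 11 8) (split 14 (split 17 (leaf 17 17 22 14) (split 19
  (leaf 14 19 23 14) (split 21 (leaf 14 21 21 14) (split 7 (leaf 7 7 14 7) (leaf 4 4 20 7) (leaf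
  8 10 10 7) (split 5 (leaf 5 5 14 6) (split 26 (leaf 6 24 26 14) (leaf 16 26 26 17) (split 3
  (leaf 3 3 6 3) (leaf 3 4 5 3) (leaf 3 3 26 8) (leaf 3 12 13 7)) (leaf 7 11 26 11)) (leaf 5 5
  10 5) (leaf 5 11 12 7))) (leaf 9 10 21 10) (leaf 11 12 21 11)) (leaf 8 9 19 9) (leaf 12 13 19
  11)) (leaf 9 10 17 9) (leaf 12 15 17 11)) (leaf 16 20 20 14) (leaf 8 10 14 8) (leaf 14 15 15
  11)))) (leaf 20 22 22 16) (leaf 8 10 22 10) (leaf 13 13 22 12)) (leaf 8 8 20 9) (leaf 12 20 20
  13)) (leaf 18 23 23 16) (leaf 8 9 23 10) (leaf 12 13 23 12))) (split 14 (split 28 (leaf 14 14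
  28 14) (leaf 16 28 28 18) (split 15 (split 20 (leaf 20 20 20 15) (split 11 (leaf 6 14 24 11)
  (leaf 4 20 20 11) (leaf 8 8 28 11) (split 21 (leaf 14 21 21 14) (split 7 (leaf 6 7 15 7) (leaf
  4 4 20 7) (split 22 (leaf 14 22 24 15) (leaf 20 22 22 16) (leaf 7 7 22 9) (leaf 10 12 22 11))
  (leaf 7 10 11 7)) (leaf 28 28 28 21) (leaf 11 12 21 11))) (leaf 8 8 20 9) (leaf 10 10 20 10))
  (split 11 (leaf 6 14 24 11) (leaf 11 15 18 11) (leaf 8 8 28 11) (split 21 (leaf 14 21 21 14)
  (leaf 18 21 21 15) (leaf 28 28 28 21) (leaf 11 12 21 11))) (leaf 8 9 15 8) (leaf 10 15 15 10))
  (leaf 10 10 28 12)) (split 19 (split 20 (split 15 (leaf 20 20 20 15) (split 26 (leaf 24 26 26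
  19) (leaf 4 26 26 14) (split 13 (leaf 13 19 20 13) (leaf 16 18 18 13) (leaf 13 13 26 13)
  (split 11 (leaf 6 19 19 11) (leaf 11 15 18 11) (leaf 9 9 26 11) (split 2 (leaf 2 2 20 6) (leaf
  2 2 4 2) (leaf 2 8 26 9) (split 3 (leaf 3 3 6 3) (leaf 4 4 4 3) (leaf 3 3 26 8) (leaf 2 3 3
  2))))) (leaf 10 12 26 12)) (leaf 8 9 15 8) (leaf 10 15 15 10)) (leaf 16 20 20 14) (leaf 8 8 20
  9) (leaf 10 10 20 10)) (leaf 18 19 19 14) (leaf 8 9 19 9) (leaf 10 19 19 12)) (leaf 8 14 14 9)
  (leaf 12 14 14 10))) (leaf 4 4 8 4) (split 32 (leaf 32 32 32 24) (leaf 16 16 32 16) (split 2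
  (split 20 (leaf 2 2 20 6) (split 14 (split 15 (split 22 (leaf 14 22 24 15) (leaf 20 22 22 16)
  (split 13 (leaf 13 15 24 13) (leaf 16 16 20 13) (leaf 8 22 22 13) (split 28 (leaf 14 14 28 14)
  (leaf 16 20 28 16) (leaf 28 28 32 22) (leaf 12 12 28 13))) (leaf 4 22 22 12)) (leaf 20 20 20
  15) (leaf 8 9 15 8) (split 10 (leaf 2 14 24 10) (leaf 10 10 20 10) (split 13 (leaf 14 14 24
  13) (leaf 16 16 20 13) (leaf 9 10 13 8) (split 21 (leaf 14 21 21 14) (split 7 (leaf 2 2 24 7)
  (split 5 (leaf 5 5 14 6) (leaf 5 5 18 7) (leaf 5 5 10 5) (leaf 4 4 12 5)) (leaf 8 10 10 7)
  (leaf 4 12 12 7)) (leaf 9 10 21 10) (leaf 12 15 21 12))) (leaf 10 15 15 10))) (leaf 16 20 20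
  14) (leaf 8 14 14 9) (split 10 (leaf 6 10 24 10) (leaf 10 10 20 10) (split 7 (leaf 2 2 24 7)
  (split 22 (split 13 (leaf 6 22 24 13) (leaf 16 16 20 13) (leaf 9 10 13 8) (split 17 (leaf 22
  22 24 17) (split 11 (leaf 2 11 11 6) (leaf 7 17 20 11) (leaf 10 11 11 8) (split 15 (split 23
  (leaf 15 22 23 15) (leaf 18 23 23 16) (leaf 8 9 23 10) (leaf 11 14 23 12)) (leaf 20 20 20 15)
  (leaf 8 9 15 8) (leaf 14 15 15 11))) (leaf 9 10 17 9) (leaf 14 17 17 12))) (leaf 20 22 22 16)
  (leaf 8 10 22 10) (leaf 4 22 22 12)) (leaf 8 10 10 7) (leaf 4 12 12 7)) (leaf 12 14 14 10)))
  (leaf 8 8 20 9) (split 14 (split 13 (leaf 14 14 24 13) (leaf 16 18 18 13) (split 30 (leaf 2 24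
  30 14) (leaf 16 18 30 16) (leaf 9 13 30 13) (leaf 20 30 30 20)) (leaf 12 20 20 13)) (split 11
  (leaf 2 11 11 6) (leaf 14 14 16 11) (split 10 (leaf 6 10 24 10) (leaf 10 14 16 10) (leaf 10 11
  11 8) (leaf 10 10 20 10)) (leaf 4 20 20 11)) (leaf 8 14 14 9) (leaf 14 14 20 12))) (split 3
  (leaf 3 3 6 3) (leaf 2 3 3 2) (split 5 (split 14 (leaf 5 5 14 6) (split 7 (leaf 6 7 7 5) (leaf
  7 7 14 7) (split 13 (leaf 5 6 13 6) (leaf 16 18 18 13) (leaf 7 8 13 7) (split 10 (leaf 5 5 10
  5) (leaf 10 14 16 10) (leaf 8 10 10 7) (split 19 (split 26 (leaf 24 26 26 19) (leaf 14 16 26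
  14) (leaf 3 3 26 8) (leaf 4 10 26 10)) (leaf 18 19 19 14) (leaf 8 9 19 9) (leaf 10 19 19
  12)))) (leaf 4 12 12 7)) (leaf 8 14 14 9) (split 30 (split 20 (leaf 20 30 30 20) (split 15
  (leaf 6 24 30 15) (leaf 20 20 20 15) (leaf 8 9 15 8) (split 10 (leaf 5 5 10 5) (leaf 2 18 20
  10) (split 13 (leaf 5 6 13 6) (leaf 16 16 20 13) (leaf 9 10 13 8) (split 21 (leaf 24 30 30 21)
  (split 11 (split 22 (leaf 11 11 22 11) (leaf 20 22 22 16) (leaf 8 10 22 10) (leaf 4 22 22 12))
  (leaf 2 21 21 11) (leaf 3 9 32 11) (leaf 14 15 15 11)) (leaf 3 8 21 8) (leaf 12 15 21 12)))
  (leaf 10 15 15 10))) (leaf 3 9 20 8) (leaf 14 14 20 12)) (leaf 16 18 30 16) (leaf 3 3 30 9)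
  (leaf 4 14 30 12))) (leaf 2 2 16 5) (leaf 3 8 9 5) (leaf 4 4 12 5)) (leaf 4 4 4 3)) (leaf 2 2
  32 9) (leaf 2 2 4 2)) (leaf 4 12 32 12))) (leaf 12 12 12 9)) (split 9 (leaf 6 6 24 9) (split 4
  (leaf 4 6 6 4) (leaf 4 16 16 9) (leaf 4 4 8 4) (split 32 (leaf 32 32 32 24) (leaf 16 16 32 16)
  (leaf 8 32 32 18) (leaf 4 12 32 12))) (leaf 9 9 18 9) (leaf 12 12 12 9)) (leaf 12 18 18 12))
  (leaf 8 12 12 8))) (split 12 (leaf 6 6 12 6) (split 8 (leaf 8 8 8 6) (leaf 8 12 12 8) (leaf 8
  8 16 8) (split 18 (leaf 24 24 24 18) (leaf 12 18 18 12) (split 9 (leaf 6 6 24 9) (leaf 12 12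
  12 9) (leaf 9 9 18 9) (split 4 (leaf 4 6 6 4) (split 32 (leaf 32 32 32 24) (leaf 4 12 32 12)
  (leaf 16 16 32 16) (split 2 (split 20 (leaf 2 2 20 6) (split 14 (split 13 (leaf 14 14 24 13)
  (leaf 12 20 20 13) (leaf 16 18 18 13) (split 30 (leaf 2 24 30 14) (leaf 20 30 30 20) (leaf 16
  18 30 16) (leaf 9 13 30 13))) (leaf 14 14 20 12) (split 11 (leaf 2 11 11 6) (leaf 4 20 20 11)
  (leaf 14 14 16 11) (split 10 (leaf 6 10 24 10) (leaf 10 10 20 10) (leaf 10 14 16 10) (leaf 10
  11 11 8))) (leaf 8 14 14 9)) (split 14 (split 15 (split 22 (leaf 14 22 24 15) (leaf 4 22 22
  12) (leaf 20 22 22 16) (split 13 (leaf 13 15 24 13) (split 28 (leaf 14 14 28 14) (leaf 12 12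
  28 13) (leaf 16 20 28 16) (leaf 28 28 32 22)) (leaf 16 16 20 13) (leaf 8 22 22 13))) (split 10
  (leaf 2 14 24 10) (leaf 10 15 15 10) (leaf 10 10 20 10) (split 13 (leaf 14 14 24 13) (split 21
  (leaf 14 21 21 14) (leaf 12 15 21 12) (split 7 (leaf 2 2 24 7) (leaf 4 12 12 7) (split 5 (leaf
  5 5 14 6) (leaf 4 4 12 5) (leaf 5 5 18 7) (leaf 5 5 10 5)) (leaf 8 10 10 7)) (leaf 9 10 21
  10)) (leaf 16 16 20 13) (leaf 9 10 13 8))) (leaf 20 20 20 15) (leaf 8 9 15 8)) (split 10 (leaf
  6 10 24 10) (leaf 12 14 14 10) (leaf 10 10 20 10) (split 7 (leaf 2 2 24 7) (leaf 4 12 12 7)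
  (split 22 (split 13 (leaf 6 22 24 13) (split 17 (leaf 22 22 24 17) (leaf 14 17 17 12) (split
  11 (leaf 2 11 11 6) (split 15 (split 23 (leaf 15 22 23 15) (leaf 11 14 23 12) (leaf 18 23 23
  16) (leaf 8 9 23 10)) (leaf 14 15 15 11) (leaf 20 20 20 15) (leaf 8 9 15 8)) (leaf 7 17 20 11)
  (leaf 10 11 11 8)) (leaf 9 10 17 9)) (leaf 16 16 20 13) (leaf 9 10 13 8)) (leaf 4 22 22 12)
  (leaf 20 22 22 16) (leaf 8 10 22 10)) (leaf 8 10 10 7))) (leaf 16 20 20 14) (leaf 8 14 14 9))
  (leaf 8 8 20 9)) (leaf 2 2 4 2) (split 3 (leaf 3 3 6 3) (leaf 4 4 4 3) (leaf 2 3 3 2) (split 5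
  (split 14 (leaf 5 5 14 6) (split 30 (split 20 (leaf 20 30 30 20) (leaf 14 14 20 12) (split 15
  (leaf 6 24 30 15) (split 10 (leaf 5 5 10 5) (leaf 10 15 15 10) (leaf 2 18 20 10) (split 13
  (leaf 5 6 13 6) (split 21 (leaf 24 30 30 21) (leaf 12 15 21 12) (split 11 (split 22 (leaf 11
  11 22 11) (leaf 4 22 22 12) (leaf 20 22 22 16) (leaf 8 10 22 10)) (leaf 14 15 15 11) (leaf 2
  21 21 11) (leaf 3 9 32 11)) (leaf 3 8 21 8)) (leaf 16 16 20 13) (leaf 9 10 13 8))) (leaf 20 20
  20 15) (leaf 8 9 15 8)) (leaf 3 9 20 8)) (leaf 4 14 30 12) (leaf 16 18 30 16) (leaf 3 3 30 9))
  (split 7 (leaf 6 7 7 5) (leaf 4 12 12 7) (leaf 7 7 14 7) (split 13 (leaf 5 6 13 6) (split 10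
  (leaf 5 5 10 5) (split 19 (split 26 (leaf 24 26 26 19) (leaf 4 10 26 10) (leaf 14 16 26 14)
  (leaf 3 3 26 8)) (leaf 10 19 19 12) (leaf 18 19 19 14) (leaf 8 9 19 9)) (leaf 10 14 16 10)
  (leaf 8 10 10 7)) (leaf 16 18 18 13) (leaf 7 8 13 7))) (leaf 8 14 14 9)) (leaf 4 4 12 5) (leaf
  2 2 16 5) (leaf 3 8 9 5))) (leaf 2 2 32 9))) (split 10 (leaf 6 10 24 10) (split 14 (split 28
  (leaf 14 14 28 14) (leaf 10 10 28 12) (leaf 16 28 28 18) (split 15 (split 20 (leaf 20 20 20
  15) (leaf 10 10 20 10) (split 11 (leaf 6 14 24 11) (split 21 (leaf 14 21 21 14) (leaf 11 12 21
  11) (split 7 (leaf 6 7 15 7) (leaf 7 10 11 7) (leaf 4 4 20 7) (split 22 (leaf 14 22 24 15)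
  (leaf 10 12 22 11) (leaf 20 22 22 16) (leaf 7 7 22 9))) (leaf 28 28 28 21)) (leaf 4 20 20 11)
  (leaf 8 8 28 11)) (leaf 8 8 20 9)) (leaf 10 15 15 10) (split 11 (leaf 6 14 24 11) (split 21
  (leaf 14 21 21 14) (leaf 11 12 21 11) (leaf 18 21 21 15) (leaf 28 28 28 21)) (leaf 11 15 18
  11) (leaf 8 8 28 11)) (leaf 8 9 15 8))) (leaf 12 14 14 10) (split 19 (split 20 (split 15 (leaf
  20 20 20 15) (leaf 10 15 15 10) (split 26 (leaf 24 26 26 19) (leaf 10 12 26 12) (leaf 4 26 26
  14) (split 13 (leaf 13 19 20 13) (split 11 (leaf 6 19 19 11) (split 2 (leaf 2 2 20 6) (split 3
  (leaf 3 3 6 3) (leaf 2 3 3 2) (leaf 4 4 4 3) (leaf 3 3 26 8)) (leaf 2 2 4 2) (leaf 2 8 26 9))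
  (leaf 11 15 18 11) (leaf 9 9 26 11)) (leaf 16 18 18 13) (leaf 13 13 26 13))) (leaf 8 9 15 8))
  (leaf 10 10 20 10) (leaf 16 20 20 14) (leaf 8 8 20 9)) (leaf 10 19 19 12) (leaf 18 19 19 14)
  (leaf 8 9 19 9)) (leaf 8 14 14 9)) (leaf 4 18 18 10) (split 13 (split 23 (leaf 6 23 23 13)
  (split 14 (leaf 14 14 24 13) (split 15 (leaf 13 15 24 13) (leaf 14 23 23 15) (split 22 (leaf 6
  22 24 13) (leaf 12 14 22 12) (leaf 16 22 22 15) (leaf 8 10 22 10)) (leaf 8 9 15 8)) (split 22
  (leaf 6 22 24 13) (split 15 (leaf 13 15 24 13) (leaf 15 22 23 15) (split 11 (split 17 (leaf 11
  17 24 13) (leaf 22 23 23 17) (split 19 (leaf 6 19 19 11) (split 7 (leaf 6 7 11 6) (leaf 7 19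
  22 12) (leaf 4 7 17 7) (leaf 8 10 10 7)) (leaf 18 19 19 14) (leaf 8 9 19 9)) (leaf 9 10 17 9))
  (leaf 11 11 22 11) (leaf 11 15 18 11) (leaf 10 11 11 8)) (leaf 8 9 15 8)) (leaf 16 18 22 14)
  (leaf 8 10 22 10)) (leaf 8 10 14 8)) (leaf 18 23 23 16) (leaf 8 9 23 10)) (split 23 (split 20
  (split 28 (leaf 24 28 28 20) (leaf 12 12 28 13) (leaf 16 28 28 18) (split 2 (leaf 2 2 20 6)
  (split 3 (leaf 3 3 6 3) (leaf 2 3 3 2) (leaf 4 4 4 3) (leaf 3 9 28 10)) (leaf 2 2 4 2) (leaf 2
  2 28 8))) (leaf 12 20 20 13) (split 22 (split 15 (leaf 15 22 23 15) (split 11 (leaf 11 11 22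
  11) (split 14 (split 17 (leaf 17 17 22 14) (leaf 12 15 17 11) (split 19 (leaf 14 19 23 14)
  (leaf 12 13 19 11) (split 21 (leaf 14 21 21 14) (leaf 11 12 21 11) (split 7 (leaf 7 7 14 7)
  (split 5 (leaf 5 5 14 6) (leaf 5 11 12 7) (split 26 (leaf 6 24 26 14) (leaf 7 11 26 11) (leaf
  16 26 26 17) (split 3 (leaf 3 3 6 3) (leaf 3 12 13 7) (leaf 3 4 5 3) (leaf 3 3 26 8))) (leaf 5
  5 10 5)) (leaf 4 4 20 7) (leaf 8 10 10 7)) (leaf 9 10 21 10)) (leaf 8 9 19 9)) (leaf 9 10 17
  9)) (leaf 14 15 15 11) (leaf 16 20 20 14) (leaf 8 10 14 8)) (leaf 4 20 20 11) (leaf 10 11 11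
  8)) (leaf 20 20 20 15) (leaf 8 9 15 8)) (leaf 13 13 22 12) (leaf 20 22 22 16) (leaf 8 10 22
  10)) (leaf 8 8 20 9)) (leaf 12 13 23 12) (leaf 18 23 23 16) (leaf 8 9 23 10)) (leaf 16 18 18
  13) (leaf 9 10 13 8))) (leaf 4 4 8 4))) (split 9 (leaf 6 6 24 9) (leaf 12 12 12 9) (split 4
  (leaf 4 6 6 4) (split 32 (leaf 32 32 32 24) (leaf 4 12 32 12) (leaf 16 16 32 16) (leaf 8 32 32
  18)) (leaf 4 16 16 9) (leaf 4 4 8 4)) (leaf 9 9 18 9)))) (leaf 16 16 16 12) (split 8 (leaf 8 8
  8 6) (split 18 (leaf 24 24 24 18) (split 9 (leaf 6 6 24 9) (leaf 9 9 18 9) (split 4 (leaf 4 6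
  6 4) (leaf 4 4 8 4) (leaf 4 16 16 9) (split 32 (leaf 32 32 32 24) (leaf 8 32 32 18) (leaf 16
  16 32 16) (leaf 4 12 32 12))) (leaf 12 12 12 9)) (split 9 (leaf 6 6 24 9) (split 4 (leaf 4 6 6
  4) (leaf 4 4 8 4) (split 10 (leaf 6 10 24 10) (split 13 (split 23 (leaf 6 23 23 13) (leaf 8 9
  23 10) (leaf 18 23 23 16) (split 14 (leaf 14 14 24 13) (leaf 8 10 14 8) (split 22 (leaf 6 22
  24 13) (leaf 8 10 22 10) (leaf 16 18 22 14) (split 15 (leaf 13 15 24 13) (leaf 8 9 15 8)
  (split 11 (split 17 (leaf 11 17 24 13) (leaf 9 10 17 9) (split 19 (leaf 6 19 19 11) (leaf 8 9
  19 9) (leaf 18 19 19 14) (split 7 (leaf 6 7 11 6) (leaf 8 10 10 7) (leaf 4 7 17 7) (leaf 7 19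
  22 12))) (leaf 22 23 23 17)) (leaf 10 11 11 8) (leaf 11 15 18 11) (leaf 11 11 22 11)) (leaf 15
  22 23 15))) (split 15 (leaf 13 15 24 13) (leaf 8 9 15 8) (split 22 (leaf 6 22 24 13) (leaf 8
  10 22 10) (leaf 16 22 22 15) (leaf 12 14 22 12)) (leaf 14 23 23 15)))) (leaf 9 10 13 8) (leaf
  16 18 18 13) (split 23 (split 20 (split 28 (leaf 24 28 28 20) (split 2 (leaf 2 2 20 6) (leaf 2
  2 28 8) (leaf 2 2 4 2) (split 3 (leaf 3 3 6 3) (leaf 3 9 28 10) (leaf 4 4 4 3) (leaf 2 3 3
  2))) (leaf 16 28 28 18) (leaf 12 12 28 13)) (leaf 8 8 20 9) (split 22 (split 15 (leaf 15 22 23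
  15) (leaf 8 9 15 8) (leaf 20 20 20 15) (split 11 (leaf 11 11 22 11) (leaf 10 11 11 8) (leaf 4
  20 20 11) (split 14 (split 17 (leaf 17 17 22 14) (leaf 9 10 17 9) (split 19 (leaf 14 19 23 14)
  (leaf 8 9 19 9) (split 21 (leaf 14 21 21 14) (leaf 9 10 21 10) (split 7 (leaf 7 7 14 7) (leaf
  8 10 10 7) (leaf 4 4 20 7) (split 5 (leaf 5 5 14 6) (leaf 5 5 10 5) (split 26 (leaf 6 24 26
  14) (split 3 (leaf 3 3 6 3) (leaf 3 3 26 8) (leaf 3 4 5 3) (leaf 3 12 13 7)) (leaf 16 26 26
  17) (leaf 7 11 26 11)) (leaf 5 11 12 7))) (leaf 11 12 21 11)) (leaf 12 13 19 11)) (leaf 12 15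
  17 11)) (leaf 8 10 14 8) (leaf 16 20 20 14) (leaf 14 15 15 11)))) (leaf 8 10 22 10) (leaf 20
  22 22 16) (leaf 13 13 22 12)) (leaf 12 20 20 13)) (leaf 8 9 23 10) (leaf 18 23 23 16) (leaf 12
  13 23 12))) (leaf 4 18 18 10) (split 14 (split 28 (leaf 14 14 28 14) (split 15 (split 20 (leaf
  20 20 20 15) (leaf 8 8 20 9) (split 11 (leaf 6 14 24 11) (leaf 8 8 28 11) (leaf 4 20 20 11)
  (split 21 (leaf 14 21 21 14) (leaf 28 28 28 21) (split 7 (leaf 6 7 15 7) (split 22 (leaf 14 22
  24 15) (leaf 7 7 22 9) (leaf 20 22 22 16) (leaf 10 12 22 11)) (leaf 4 4 20 7) (leaf 7 10 11
  7)) (leaf 11 12 21 11))) (leaf 10 10 20 10)) (leaf 8 9 15 8) (split 11 (leaf 6 14 24 11) (leaf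
  8 8 28 11) (leaf 11 15 18 11) (split 21 (leaf 14 21 21 14) (leaf 28 28 28 21) (leaf 18 21 21
  15) (leaf 11 12 21 11))) (leaf 10 15 15 10)) (leaf 16 28 28 18) (leaf 10 10 28 12)) (leaf 8 14
  14 9) (split 19 (split 20 (split 15 (leaf 20 20 20 15) (leaf 8 9 15 8) (split 26 (leaf 24 26
  26 19) (split 13 (leaf 13 19 20 13) (leaf 13 13 26 13) (leaf 16 18 18 13) (split 11 (leaf 6 19
  19 11) (leaf 9 9 26 11) (leaf 11 15 18 11) (split 2 (leaf 2 2 20 6) (leaf 2 8 26 9) (leaf 2 2
  4 2) (split 3 (leaf 3 3 6 3) (leaf 3 3 26 8) (leaf 4 4 4 3) (leaf 2 3 3 2))))) (leaf 4 26 26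
  14) (leaf 10 12 26 12)) (leaf 10 15 15 10)) (leaf 8 8 20 9) (leaf 16 20 20 14) (leaf 10 10 20
  10)) (leaf 8 9 19 9) (leaf 18 19 19 14) (leaf 10 19 19 12)) (leaf 12 14 14 10))) (split 32
  (leaf 32 32 32 24) (split 2 (split 20 (leaf 2 2 20 6) (leaf 8 8 20 9) (split 14 (split 15
  (split 22 (leaf 14 22 24 15) (split 13 (leaf 13 15 24 13) (leaf 8 22 22 13) (leaf 16 16 20 13)
  (split 28 (leaf 14 14 28 14) (leaf 28 28 32 22) (leaf 16 20 28 16) (leaf 12 12 28 13))) (leaf
  20 22 22 16) (leaf 4 22 22 12)) (leaf 8 9 15 8) (leaf 20 20 20 15) (split 10 (leaf 2 14 24 10)
  (split 13 (leaf 14 14 24 13) (leaf 9 10 13 8) (leaf 16 16 20 13) (split 21 (leaf 14 21 21 14)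
  (leaf 9 10 21 10) (split 7 (leaf 2 2 24 7) (leaf 8 10 10 7) (split 5 (leaf 5 5 14 6) (leaf 5 5
  10 5) (leaf 5 5 18 7) (leaf 4 4 12 5)) (leaf 4 12 12 7)) (leaf 12 15 21 12))) (leaf 10 10 20
  10) (leaf 10 15 15 10))) (leaf 8 14 14 9) (leaf 16 20 20 14) (split 10 (leaf 6 10 24 10)
  (split 7 (leaf 2 2 24 7) (leaf 8 10 10 7) (split 22 (split 13 (leaf 6 22 24 13) (leaf 9 10 13
  8) (leaf 16 16 20 13) (split 17 (leaf 22 22 24 17) (leaf 9 10 17 9) (split 11 (leaf 2 11 11 6)
  (leaf 10 11 11 8) (leaf 7 17 20 11) (split 15 (split 23 (leaf 15 22 23 15) (leaf 8 9 23 10)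
  (leaf 18 23 23 16) (leaf 11 14 23 12)) (leaf 8 9 15 8) (leaf 20 20 20 15) (leaf 14 15 15 11)))
  (leaf 14 17 17 12))) (leaf 8 10 22 10) (leaf 20 22 22 16) (leaf 4 22 22 12)) (leaf 4 12 12 7))
  (leaf 10 10 20 10) (leaf 12 14 14 10))) (split 14 (split 13 (leaf 14 14 24 13) (split 30 (leaf
  2 24 30 14) (leaf 9 13 30 13) (leaf 16 18 30 16) (leaf 20 30 30 20)) (leaf 16 18 18 13) (leaf
  12 20 20 13)) (leaf 8 14 14 9) (split 11 (leaf 2 11 11 6) (split 10 (leaf 6 10 24 10) (leaf 10
  11 11 8) (leaf 10 14 16 10) (leaf 10 10 20 10)) (leaf 14 14 16 11) (leaf 4 20 20 11)) (leaf 14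
  14 20 12))) (leaf 2 2 32 9) (split 3 (leaf 3 3 6 3) (split 5 (split 14 (leaf 5 5 14 6) (leaf 8
  14 14 9) (split 7 (leaf 6 7 7 5) (split 13 (leaf 5 6 13 6) (leaf 7 8 13 7) (leaf 16 18 18 13)
  (split 10 (leaf 5 5 10 5) (leaf 8 10 10 7) (leaf 10 14 16 10) (split 19 (split 26 (leaf 24 26
  26 19) (leaf 3 3 26 8) (leaf 14 16 26 14) (leaf 4 10 26 10)) (leaf 8 9 19 9) (leaf 18 19 19
  14) (leaf 10 19 19 12)))) (leaf 7 7 14 7) (leaf 4 12 12 7)) (split 30 (split 20 (leaf 20 30 30
  20) (leaf 3 9 20 8) (split 15 (leaf 6 24 30 15) (leaf 8 9 15 8) (leaf 20 20 20 15) (split 10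
  (leaf 5 5 10 5) (split 13 (leaf 5 6 13 6) (leaf 9 10 13 8) (leaf 16 16 20 13) (split 21 (leaf
  24 30 30 21) (leaf 3 8 21 8) (split 11 (split 22 (leaf 11 11 22 11) (leaf 8 10 22 10) (leaf 20
  22 22 16) (leaf 4 22 22 12)) (leaf 3 9 32 11) (leaf 2 21 21 11) (leaf 14 15 15 11)) (leaf 12
  15 21 12))) (leaf 2 18 20 10) (leaf 10 15 15 10))) (leaf 14 14 20 12)) (leaf 3 3 30 9) (leaf
  16 18 30 16) (leaf 4 14 30 12))) (leaf 3 8 9 5) (leaf 2 2 16 5) (leaf 4 4 12 5)) (leaf 2 3 3
  2) (leaf 4 4 4 3)) (leaf 2 2 4 2)) (leaf 16 16 32 16) (leaf 4 12 32 12))) (leaf 9 9 18 9)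
  (leaf 12 12 12 9)) (leaf 12 18 18 12)) (leaf 8 8 16 8) (leaf 8 12 12 8))) (split 12 (leaf 6 6
  12 6) (split 8 (leaf 8 8 8 6) (leaf 8 12 12 8) (split 18 (leaf 24 24 24 18) (leaf 12 18 18 12)
  (split 9 (leaf 6 6 24 9) (leaf 12 12 12 9) (leaf 9 9 18 9) (split 4 (leaf 4 6 6 4) (split 32
  (leaf 32 32 32 24) (leaf 4 12 32 12) (leaf 8 32 32 18) (leaf 16 16 32 16)) (leaf 4 4 8 4)
  (leaf 4 16 16 9))) (split 9 (leaf 6 6 24 9) (leaf 12 12 12 9) (split 4 (leaf 4 6 6 4) (split
  32 (leaf 32 32 32 24) (leaf 4 12 32 12) (split 2 (split 20 (leaf 2 2 20 6) (split 14 (split 13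
  (leaf 14 14 24 13) (leaf 12 20 20 13) (split 30 (leaf 2 24 30 14) (leaf 20 30 30 20) (leaf 9
  13 30 13) (leaf 16 18 30 16)) (leaf 16 18 18 13)) (leaf 14 14 20 12) (leaf 8 14 14 9) (split
  11 (leaf 2 11 11 6) (leaf 4 20 20 11) (split 10 (leaf 6 10 24 10) (leaf 10 10 20 10) (leaf 10
  11 11 8) (leaf 10 14 16 10)) (leaf 14 14 16 11))) (leaf 8 8 20 9) (split 14 (split 15 (split
  22 (leaf 14 22 24 15) (leaf 4 22 22 12) (split 13 (leaf 13 15 24 13) (split 28 (leaf 14 14 28
  14) (leaf 12 12 28 13) (leaf 28 28 32 22) (leaf 16 20 28 16)) (leaf 8 22 22 13) (leaf 16 16 20
  13)) (leaf 20 22 22 16)) (split 10 (leaf 2 14 24 10) (leaf 10 15 15 10) (split 13 (leaf 14 14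
  24 13) (split 21 (leaf 14 21 21 14) (leaf 12 15 21 12) (leaf 9 10 21 10) (split 7 (leaf 2 2 24
  7) (leaf 4 12 12 7) (leaf 8 10 10 7) (split 5 (leaf 5 5 14 6) (leaf 4 4 12 5) (leaf 5 5 10 5)
  (leaf 5 5 18 7)))) (leaf 9 10 13 8) (leaf 16 16 20 13)) (leaf 10 10 20 10)) (leaf 8 9 15 8)
  (leaf 20 20 20 15)) (split 10 (leaf 6 10 24 10) (leaf 12 14 14 10) (split 7 (leaf 2 2 24 7)
  (leaf 4 12 12 7) (leaf 8 10 10 7) (split 22 (split 13 (leaf 6 22 24 13) (split 17 (leaf 22 22
  24 17) (leaf 14 17 17 12) (leaf 9 10 17 9) (split 11 (leaf 2 11 11 6) (split 15 (split 23
  (leaf 15 22 23 15) (leaf 11 14 23 12) (leaf 8 9 23 10) (leaf 18 23 23 16)) (leaf 14 15 15 11)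
  (leaf 8 9 15 8) (leaf 20 20 20 15)) (leaf 10 11 11 8) (leaf 7 17 20 11))) (leaf 9 10 13 8)
  (leaf 16 16 20 13)) (leaf 4 22 22 12) (leaf 8 10 22 10) (leaf 20 22 22 16))) (leaf 10 10 20
  10)) (leaf 8 14 14 9) (leaf 16 20 20 14))) (leaf 2 2 4 2) (leaf 2 2 32 9) (split 3 (leaf 3 3 6
  3) (leaf 4 4 4 3) (split 5 (split 14 (leaf 5 5 14 6) (split 30 (split 20 (leaf 20 30 30 20)
  (leaf 14 14 20 12) (leaf 3 9 20 8) (split 15 (leaf 6 24 30 15) (split 10 (leaf 5 5 10 5) (leaf
  10 15 15 10) (split 13 (leaf 5 6 13 6) (split 21 (leaf 24 30 30 21) (leaf 12 15 21 12) (leaf 3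
  8 21 8) (split 11 (split 22 (leaf 11 11 22 11) (leaf 4 22 22 12) (leaf 8 10 22 10) (leaf 20 22
  22 16)) (leaf 14 15 15 11) (leaf 3 9 32 11) (leaf 2 21 21 11))) (leaf 9 10 13 8) (leaf 16 16
  20 13)) (leaf 2 18 20 10)) (leaf 8 9 15 8) (leaf 20 20 20 15))) (leaf 4 14 30 12) (leaf 3 3 30
  9) (leaf 16 18 30 16)) (leaf 8 14 14 9) (split 7 (leaf 6 7 7 5) (leaf 4 12 12 7) (split 13
  (leaf 5 6 13 6) (split 10 (leaf 5 5 10 5) (split 19 (split 26 (leaf 24 26 26 19) (leaf 4 10 26
  10) (leaf 3 3 26 8) (leaf 14 16 26 14)) (leaf 10 19 19 12) (leaf 8 9 19 9) (leaf 18 19 19 14))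
  (leaf 8 10 10 7) (leaf 10 14 16 10)) (leaf 7 8 13 7) (leaf 16 18 18 13)) (leaf 7 7 14 7)))
  (leaf 4 4 12 5) (leaf 3 8 9 5) (leaf 2 2 16 5)) (leaf 2 3 3 2))) (leaf 16 16 32 16)) (leaf 4 4
  8 4) (split 10 (leaf 6 10 24 10) (split 14 (split 28 (leaf 14 14 28 14) (leaf 10 10 28 12)
  (split 15 (split 20 (leaf 20 20 20 15) (leaf 10 10 20 10) (leaf 8 8 20 9) (split 11 (leaf 6 14
  24 11) (split 21 (leaf 14 21 21 14) (leaf 11 12 21 11) (leaf 28 28 28 21) (split 7 (leaf 6 7
  15 7) (leaf 7 10 11 7) (split 22 (leaf 14 22 24 15) (leaf 10 12 22 11) (leaf 7 7 22 9) (leaf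
  20 22 22 16)) (leaf 4 4 20 7))) (leaf 8 8 28 11) (leaf 4 20 20 11))) (leaf 10 15 15 10) (leaf
  8 9 15 8) (split 11 (leaf 6 14 24 11) (split 21 (leaf 14 21 21 14) (leaf 11 12 21 11) (leaf 28
  28 28 21) (leaf 18 21 21 15)) (leaf 8 8 28 11) (leaf 11 15 18 11))) (leaf 16 28 28 18)) (leaf
  12 14 14 10) (leaf 8 14 14 9) (split 19 (split 20 (split 15 (leaf 20 20 20 15) (leaf 10 15 15
  10) (leaf 8 9 15 8) (split 26 (leaf 24 26 26 19) (leaf 10 12 26 12) (split 13 (leaf 13 19 20
  13) (split 11 (leaf 6 19 19 11) (split 2 (leaf 2 2 20 6) (split 3 (leaf 3 3 6 3) (leaf 2 3 3
  2) (leaf 3 3 26 8) (leaf 4 4 4 3)) (leaf 2 8 26 9) (leaf 2 2 4 2)) (leaf 9 9 26 11) (leaf 11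
  15 18 11)) (leaf 13 13 26 13) (leaf 16 18 18 13)) (leaf 4 26 26 14))) (leaf 10 10 20 10) (leaf
  8 8 20 9) (leaf 16 20 20 14)) (leaf 10 19 19 12) (leaf 8 9 19 9) (leaf 18 19 19 14))) (split
  13 (split 23 (leaf 6 23 23 13) (split 14 (leaf 14 14 24 13) (split 15 (leaf 13 15 24 13) (leaf
  14 23 23 15) (leaf 8 9 15 8) (split 22 (leaf 6 22 24 13) (leaf 12 14 22 12) (leaf 8 10 22 10)
  (leaf 16 22 22 15))) (leaf 8 10 14 8) (split 22 (leaf 6 22 24 13) (split 15 (leaf 13 15 24 13)
  (leaf 15 22 23 15) (leaf 8 9 15 8) (split 11 (split 17 (leaf 11 17 24 13) (leaf 22 23 23 17)
  (leaf 9 10 17 9) (split 19 (leaf 6 19 19 11) (split 7 (leaf 6 7 11 6) (leaf 7 19 22 12) (leaf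
  8 10 10 7) (leaf 4 7 17 7)) (leaf 8 9 19 9) (leaf 18 19 19 14))) (leaf 11 11 22 11) (leaf 10
  11 11 8) (leaf 11 15 18 11))) (leaf 8 10 22 10) (leaf 16 18 22 14))) (leaf 8 9 23 10) (leaf 18
  23 23 16)) (split 23 (split 20 (split 28 (leaf 24 28 28 20) (leaf 12 12 28 13) (split 2 (leaf
  2 2 20 6) (split 3 (leaf 3 3 6 3) (leaf 2 3 3 2) (leaf 3 9 28 10) (leaf 4 4 4 3)) (leaf 2 2 28
  8) (leaf 2 2 4 2)) (leaf 16 28 28 18)) (leaf 12 20 20 13) (leaf 8 8 20 9) (split 22 (split 15
  (leaf 15 22 23 15) (split 11 (leaf 11 11 22 11) (split 14 (split 17 (leaf 17 17 22 14) (leaf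
  12 15 17 11) (leaf 9 10 17 9) (split 19 (leaf 14 19 23 14) (leaf 12 13 19 11) (leaf 8 9 19 9)
  (split 21 (leaf 14 21 21 14) (leaf 11 12 21 11) (leaf 9 10 21 10) (split 7 (leaf 7 7 14 7)
  (split 5 (leaf 5 5 14 6) (leaf 5 11 12 7) (leaf 5 5 10 5) (split 26 (leaf 6 24 26 14) (leaf 7
  11 26 11) (split 3 (leaf 3 3 6 3) (leaf 3 12 13 7) (leaf 3 3 26 8) (leaf 3 4 5 3)) (leaf 16 26
  26 17))) (leaf 8 10 10 7) (leaf 4 4 20 7))))) (leaf 14 15 15 11) (leaf 8 10 14 8) (leaf 16 20
  20 14)) (leaf 10 11 11 8) (leaf 4 20 20 11)) (leaf 8 9 15 8) (leaf 20 20 20 15)) (leaf 13 13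
  22 12) (leaf 8 10 22 10) (leaf 20 22 22 16))) (leaf 12 13 23 12) (leaf 8 9 23 10) (leaf 18 23
  23 16)) (leaf 9 10 13 8) (leaf 16 18 18 13)) (leaf 4 18 18 10))) (leaf 9 9 18 9))) (leaf 8 8
  16 8)) (split 8 (leaf 8 8 8 6) (split 18 (leaf 24 24 24 18) (split 9 (leaf 6 6 24 9) (leaf 9 9
  18 9) (leaf 12 12 12 9) (split 4 (leaf 4 6 6 4) (leaf 4 4 8 4) (split 32 (leaf 32 32 32 24)
  (leaf 8 32 32 18) (leaf 4 12 32 12) (leaf 16 16 32 16)) (leaf 4 16 16 9))) (leaf 12 18 18 12)
  (split 9 (leaf 6 6 24 9) (split 4 (leaf 4 6 6 4) (leaf 4 4 8 4) (split 32 (leaf 32 32 32 24)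
  (split 2 (split 20 (leaf 2 2 20 6) (leaf 8 8 20 9) (split 14 (split 13 (leaf 14 14 24 13)
  (split 30 (leaf 2 24 30 14) (leaf 9 13 30 13) (leaf 20 30 30 20) (leaf 16 18 30 16)) (leaf 12
  20 20 13) (leaf 16 18 18 13)) (leaf 8 14 14 9) (leaf 14 14 20 12) (split 11 (leaf 2 11 11 6)
  (split 10 (leaf 6 10 24 10) (leaf 10 11 11 8) (leaf 10 10 20 10) (leaf 10 14 16 10)) (leaf 4
  20 20 11) (leaf 14 14 16 11))) (split 14 (split 15 (split 22 (leaf 14 22 24 15) (split 13
  (leaf 13 15 24 13) (leaf 8 22 22 13) (split 28 (leaf 14 14 28 14) (leaf 28 28 32 22) (leaf 12
  12 28 13) (leaf 16 20 28 16)) (leaf 16 16 20 13)) (leaf 4 22 22 12) (leaf 20 22 22 16)) (leaf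
  8 9 15 8) (split 10 (leaf 2 14 24 10) (split 13 (leaf 14 14 24 13) (leaf 9 10 13 8) (split 21
  (leaf 14 21 21 14) (leaf 9 10 21 10) (leaf 12 15 21 12) (split 7 (leaf 2 2 24 7) (leaf 8 10 10
  7) (leaf 4 12 12 7) (split 5 (leaf 5 5 14 6) (leaf 5 5 10 5) (leaf 4 4 12 5) (leaf 5 5 18
  7)))) (leaf 16 16 20 13)) (leaf 10 15 15 10) (leaf 10 10 20 10)) (leaf 20 20 20 15)) (leaf 8
  14 14 9) (split 10 (leaf 6 10 24 10) (split 7 (leaf 2 2 24 7) (leaf 8 10 10 7) (leaf 4 12 12
  7) (split 22 (split 13 (leaf 6 22 24 13) (leaf 9 10 13 8) (split 17 (leaf 22 22 24 17) (leaf 9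
  10 17 9) (leaf 14 17 17 12) (split 11 (leaf 2 11 11 6) (leaf 10 11 11 8) (split 15 (split 23
  (leaf 15 22 23 15) (leaf 8 9 23 10) (leaf 11 14 23 12) (leaf 18 23 23 16)) (leaf 8 9 15 8)
  (leaf 14 15 15 11) (leaf 20 20 20 15)) (leaf 7 17 20 11))) (leaf 16 16 20 13)) (leaf 8 10 22
  10) (leaf 4 22 22 12) (leaf 20 22 22 16))) (leaf 12 14 14 10) (leaf 10 10 20 10)) (leaf 16 20
  20 14))) (leaf 2 2 32 9) (leaf 2 2 4 2) (split 3 (leaf 3 3 6 3) (split 5 (split 14 (leaf 5 5
  14 6) (leaf 8 14 14 9) (split 30 (split 20 (leaf 20 30 30 20) (leaf 3 9 20 8) (leaf 14 14 20
  12) (split 15 (leaf 6 24 30 15) (leaf 8 9 15 8) (split 10 (leaf 5 5 10 5) (split 13 (leaf 5 6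
  13 6) (leaf 9 10 13 8) (split 21 (leaf 24 30 30 21) (leaf 3 8 21 8) (leaf 12 15 21 12) (split
  11 (split 22 (leaf 11 11 22 11) (leaf 8 10 22 10) (leaf 4 22 22 12) (leaf 20 22 22 16)) (leaf
  3 9 32 11) (leaf 14 15 15 11) (leaf 2 21 21 11))) (leaf 16 16 20 13)) (leaf 10 15 15 10) (leaf
  2 18 20 10)) (leaf 20 20 20 15))) (leaf 3 3 30 9) (leaf 4 14 30 12) (leaf 16 18 30 16)) (split
  7 (leaf 6 7 7 5) (split 13 (leaf 5 6 13 6) (leaf 7 8 13 7) (split 10 (leaf 5 5 10 5) (leaf 8
  10 10 7) (split 19 (split 26 (leaf 24 26 26 19) (leaf 3 3 26 8) (leaf 4 10 26 10) (leaf 14 16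
  26 14)) (leaf 8 9 19 9) (leaf 10 19 19 12) (leaf 18 19 19 14)) (leaf 10 14 16 10)) (leaf 16 18
  18 13)) (leaf 4 12 12 7) (leaf 7 7 14 7))) (leaf 3 8 9 5) (leaf 4 4 12 5) (leaf 2 2 16 5))
  (leaf 4 4 4 3) (leaf 2 3 3 2))) (leaf 4 12 32 12) (leaf 16 16 32 16)) (split 10 (leaf 6 10 24
  10) (split 13 (split 23 (leaf 6 23 23 13) (leaf 8 9 23 10) (split 14 (leaf 14 14 24 13) (leaf
  8 10 14 8) (split 15 (leaf 13 15 24 13) (leaf 8 9 15 8) (leaf 14 23 23 15) (split 22 (leaf 6
  22 24 13) (leaf 8 10 22 10) (leaf 12 14 22 12) (leaf 16 22 22 15))) (split 22 (leaf 6 22 24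
  13) (leaf 8 10 22 10) (split 15 (leaf 13 15 24 13) (leaf 8 9 15 8) (leaf 15 22 23 15) (split
  11 (split 17 (leaf 11 17 24 13) (leaf 9 10 17 9) (leaf 22 23 23 17) (split 19 (leaf 6 19 19
  11) (leaf 8 9 19 9) (split 7 (leaf 6 7 11 6) (leaf 8 10 10 7) (leaf 7 19 22 12) (leaf 4 7 17
  7)) (leaf 18 19 19 14))) (leaf 10 11 11 8) (leaf 11 11 22 11) (leaf 11 15 18 11))) (leaf 16 18
  22 14))) (leaf 18 23 23 16)) (leaf 9 10 13 8) (split 23 (split 20 (split 28 (leaf 24 28 28 20)
  (split 2 (leaf 2 2 20 6) (leaf 2 2 28 8) (split 3 (leaf 3 3 6 3) (leaf 3 9 28 10) (leaf 2 3 3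
  2) (leaf 4 4 4 3)) (leaf 2 2 4 2)) (leaf 12 12 28 13) (leaf 16 28 28 18)) (leaf 8 8 20 9)
  (leaf 12 20 20 13) (split 22 (split 15 (leaf 15 22 23 15) (leaf 8 9 15 8) (split 11 (leaf 11
  11 22 11) (leaf 10 11 11 8) (split 14 (split 17 (leaf 17 17 22 14) (leaf 9 10 17 9) (leaf 12
  15 17 11) (split 19 (leaf 14 19 23 14) (leaf 8 9 19 9) (leaf 12 13 19 11) (split 21 (leaf 14
  21 21 14) (leaf 9 10 21 10) (leaf 11 12 21 11) (split 7 (leaf 7 7 14 7) (leaf 8 10 10 7)
  (split 5 (leaf 5 5 14 6) (leaf 5 5 10 5) (leaf 5 11 12 7) (split 26 (leaf 6 24 26 14) (split 3
  (leaf 3 3 6 3) (leaf 3 3 26 8) (leaf 3 12 13 7) (leaf 3 4 5 3)) (leaf 7 11 26 11) (leaf 16 26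
  26 17))) (leaf 4 4 20 7))))) (leaf 8 10 14 8) (leaf 14 15 15 11) (leaf 16 20 20 14)) (leaf 4
  20 20 11)) (leaf 20 20 20 15)) (leaf 8 10 22 10) (leaf 13 13 22 12) (leaf 20 22 22 16))) (leaf
  8 9 23 10) (leaf 12 13 23 12) (leaf 18 23 23 16)) (leaf 16 18 18 13)) (split 14 (split 28
  (leaf 14 14 28 14) (split 15 (split 20 (leaf 20 20 20 15) (leaf 8 8 20 9) (leaf 10 10 20 10)
  (split 11 (leaf 6 14 24 11) (leaf 8 8 28 11) (split 21 (leaf 14 21 21 14) (leaf 28 28 28 21)
  (leaf 11 12 21 11) (split 7 (leaf 6 7 15 7) (split 22 (leaf 14 22 24 15) (leaf 7 7 22 9) (leaf
  10 12 22 11) (leaf 20 22 22 16)) (leaf 7 10 11 7) (leaf 4 4 20 7))) (leaf 4 20 20 11))) (leaf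
  8 9 15 8) (leaf 10 15 15 10) (split 11 (leaf 6 14 24 11) (leaf 8 8 28 11) (split 21 (leaf 14
  21 21 14) (leaf 28 28 28 21) (leaf 11 12 21 11) (leaf 18 21 21 15)) (leaf 11 15 18 11))) (leaf
  10 10 28 12) (leaf 16 28 28 18)) (leaf 8 14 14 9) (leaf 12 14 14 10) (split 19 (split 20
  (split 15 (leaf 20 20 20 15) (leaf 8 9 15 8) (leaf 10 15 15 10) (split 26 (leaf 24 26 26 19)
  (split 13 (leaf 13 19 20 13) (leaf 13 13 26 13) (split 11 (leaf 6 19 19 11) (leaf 9 9 26 11)
  (split 2 (leaf 2 2 20 6) (leaf 2 8 26 9) (split 3 (leaf 3 3 6 3) (leaf 3 3 26 8) (leaf 2 3 3
  2) (leaf 4 4 4 3)) (leaf 2 2 4 2)) (leaf 11 15 18 11)) (leaf 16 18 18 13)) (leaf 10 12 26 12)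
  (leaf 4 26 26 14))) (leaf 8 8 20 9) (leaf 10 10 20 10) (leaf 16 20 20 14)) (leaf 8 9 19 9)
  (leaf 10 19 19 12) (leaf 18 19 19 14))) (leaf 4 18 18 10))) (leaf 12 12 12 9) (leaf 9 9 18
  9))) (leaf 8 12 12 8) (leaf 8 8 16 8)) (leaf 16 16 16 12))

certificate-refutes : Refutes ((6 , zero) ∷ (24 , zero) ∷ []) certificate
certificate-refutes = from-yes (refutes? ((6 , zero) ∷ (24 , zero) ∷ []) certificate)

NoMonoSolution⇒c[1]≡0⇒c[4]≢0 : ∀ {c} → NoMonoSolution c → c 1ℚ ≡ zero → c 4ℚ ≢ zero
NoMonoSolution⇒c[1]≡0⇒c[4]≢0 noMono c1 c4 =
  Refutes-sound noMono certificate certificate-refutes (c1 ∷ c4 ∷ [])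

lemma33 : (c : ℚ → Fin 4) → NoMonoSolution c →
    (x : ℚ) → x ≢ 0ℚ → c x ≢ c (4ℚ * x)
lemma33 c noMono x x≢0 cx≡c4x = NoMonoSolution⇒c[1]≡0⇒c[4]≢0 noMono′ c′1≡0 c′4≡0
  where
  σ : Fin 4 → Fin 4
  σ = transpose (c x) zero

  noMono′ : NoMonoSolution (σ ∘ c ∘ (_* x))
  noMono′ = NoMonoSolution-recolour (transpose-injective (c x) zero)
              (NoMonoSolution-dilate x x≢0 noMono)

  c′1≡0 : σ (c (1ℚ * x)) ≡ zero
  c′1≡0 = trans (cong (σ ∘ c) (*-identityˡ x)) (transpose-matchˡ (c x) zero)

  c′4≡0 : σ (c (4ℚ * x)) ≡ zero
  c′4≡0 = trans (cong σ (sym cx≡c4x)) (transpose-matchˡ (c x) zero)
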